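{- Let $(a_n)_{n\ge1}$ be a periodic E-sequence, i.e. there are integers $l\ge0$, $r\ge1$ with $a_n=a_{n+r}$ for all $n>l$. If $(a_n)$ is $\Omega$-convergent to the odd positive integer $x$, then the trajectory $(x_n)_{n\ge0}$ of $x$ is periodic, i.e. there exist integers $l'\ge0$, $r'\ge1$ with $x_n=x_{n+r'}$ for all $n>l'$.
   Context: An E-sequence is any infinite sequence $(a_n)_{n\ge1}$ of positive integers. For an odd positive integer $x$, its trajectory $(x_n)_{n\ge0}$ and its E-sequence $(a_n)_{n\ge1}$ are defined by $x_0=x$ and, for $n\ge1$, $x_n=\frac{3x_{n-1}+1}{2^{a_n}}$, where $a_n$ is the exponent of the largest power of $2$ dividing $3x_{n-1}+1$. An E-sequence is $\Omega$-convergent to $x$ if it is the E-sequence of $x$. -}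

module Defs where

open import Data.Nat using (ℕ; zero; suc; _+_; _*_; _/_; _%_; _≤_; _<_)
open import Data.Nat.Divisibility using (_∣_)
open import Data.Product using (Σ; _×_; ∃)
open import Relation.Binary.PropositionalEquality using (_≡_)

-- Repeated halving with fuel.  For m ≥ 1, fuel m suffices (2^m > m),
-- so  v2 m  is the exponent of the largest power of 2 dividing m and
-- oddPart m = m / 2^(v2 m).
v2-fuel : ℕ → ℕ → ℕ
v2-fuel zero    m = zero
v2-fuel (suc f) m with m % 2
... | zero  = suc (v2-fuel f (m / 2))
... | suc _ = zero

oddPart-fuel : ℕ → ℕ → ℕ
oddPart-fuel zero    m = m
oddPart-fuel (suc f) m with m % 2
... | zero  = oddPart-fuel f (m / 2)
... | suc _ = m

v2 : ℕ → ℕ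
v2 m = v2-fuel m m

oddPart : ℕ → ℕ
oddPart m = oddPart-fuel m m

traj : ℕ → ℕ → ℕ
traj x zero    = x
traj x (suc n) = oddPart (3 * traj x n + 1)

-- E-sequence of x, indexed from 1:  a_n = v2 (3 x_{n-1} + 1)  for n ≥ 1
-- (eseq x 0 is an unused dummy value 0; only indices n ≥ 1 are meaningful)
eseq : ℕ → ℕ → ℕ
eseq x zero    = zero
eseq x (suc n) = v2 (3 * traj x n + 1)

Odd : ℕ → Set
Odd x = x % 2 ≡ 1

-- An E-sequence (a_n)_{n≥1} of positive integers, represented as ℕ → ℕ
-- where index 0 is ignored.
IsESequence : (ℕ → ℕ) → Set
IsESequence a = ∀ n → 1 ≤ n → 1 ≤ a n

ΩConvergent : (ℕ → ℕ) → ℕ → Set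
ΩConvergent a x = ∀ n → 1 ≤ n → a n ≡ eseq x n

Periodic : (ℕ → ℕ) → Set
Periodic a = Σ ℕ λ l → Σ ℕ λ r → 1 ≤ r × (∀ n → l < n → a n ≡ a (n + r))

module Submission where

-- Write the trajectory step as
--   3 · x_n + 1 = 2^(a_{n+1}) · x_{n+1}.
-- If two sequences u, v obey this recursion with the SAME exponents
-- b_k ≥ 1, their distance g_k = |u_k - v_k| satisfies 3 · g_k = 2^(b_k) · g_{k+1},
-- so 2 ∣ g_k for every k, then 4 ∣ g_k, and inductively 2^m ∣ g_k for every m;
-- hence g_k = 0 and u = v.  The argument works verbatim for any odd multiplier
-- q and any additive constant, which is the generality stated below.
--
-- For the theorem, the E-sequence of x
-- equals the periodic sequence a, so the tails starting at l and at l + r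
-- have the same E-sequence and therefore coincide.

open import Defs
open import Data.Nat using (ℕ; zero; suc; _+_; _*_; _∸_; _^_; _/_; _%_; _≤_; _<_; ∣_-_∣; s≤s; z≤n)
open import Data.Nat.Properties
open import Data.Nat.DivMod using (m≡m%n+[m/n]*n)
open import Data.Nat.Divisibility using (_∣_; divides; ∣⇒≤; ∣-refl; ∣-trans; *-pres-∣; n∣m*n; ∣m+n∣m⇒∣n)
open import Data.Product using (_,_)
open import Data.Empty using (⊥-elim)
open import Relation.Binary.PropositionalEquality

halving-factorisation : ∀ f m → m ≡ 2 ^ v2-fuel f m * oddPart-fuel f m
halving-factorisation zero    m = sym (+-identityʳ m)
halving-factorisation (suc f) m with m % 2 in m%2≡
... | suc _ = sym (+-identityʳ m)
... | zero  = begin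
  m                                      ≡⟨ m≡m%n+[m/n]*n m 2 ⟩
  m % 2 + m / 2 * 2                      ≡⟨ cong (_+ m / 2 * 2) m%2≡ ⟩
  m / 2 * 2                              ≡⟨ *-comm (m / 2) 2 ⟩
  2 * (m / 2)                            ≡⟨ cong (2 *_) (halving-factorisation f (m / 2)) ⟩
  2 * (2 ^ v2-fuel f h * oddPart-fuel f h) ≡⟨ *-assoc 2 (2 ^ v2-fuel f h) (oddPart-fuel f h) ⟨
  2 ^ suc (v2-fuel f h) * oddPart-fuel f h ∎
  where
  open ≡-Reasoning
  h : ℕ
  h = m / 2

trajectory-step : ∀ x n → 3 * traj x n + 1 ≡ 2 ^ eseq x (suc n) * traj x (suc n)
trajectory-step x n = halving-factorisation (3 * traj x n + 1) (3 * traj x n + 1)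

n<2^n : ∀ n → n < 2 ^ n
n<2^n zero    = s≤s z≤n
n<2^n (suc n) = subst (suc (suc n) ≤_) (cong (2 ^ n +_) (sym (+-identityʳ (2 ^ n))))
                      (+-mono-≤ (m^n>0 2 n) (n<2^n n))

divisible-by-all-powers-of-2⇒0 : ∀ g → (∀ m → 2 ^ m ∣ g) → g ≡ 0
divisible-by-all-powers-of-2⇒0 zero    _   = refl
divisible-by-all-powers-of-2⇒0 (suc g) div = ⊥-elim (<⇒≱ (n<2^n (suc g)) (∣⇒≤ (div (suc g))))

module TwoAdicRigidity
  (d c : ℕ) (u v b : ℕ → ℕ)
  (u-step : ∀ k → (1 + 2 * d) * u k + c ≡ 2 ^ b k * u (suc k))
  (v-step : ∀ k → (1 + 2 * d) * v k + c ≡ 2 ^ b k * v (suc k))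
  (b-positive : ∀ k → 1 ≤ b k)
  where

  q : ℕ
  q = 1 + 2 * d

  gap : ℕ → ℕ
  gap k = ∣ u k - v k ∣

  gap-step : ∀ k → q * gap k ≡ 2 ^ b k * gap (suc k)
  gap-step k = begin
    q * ∣ u k - v k ∣                      ≡⟨ *-distribˡ-∣-∣ q (u k) (v k) ⟩
    ∣ q * u k - q * v k ∣                  ≡⟨ ∣m+n-m+o∣≡∣n-o∣ c (q * u k) (q * v k) ⟨
    ∣ c + q * u k - c + q * v k ∣          ≡⟨ cong₂ ∣_-_∣ (+-comm c (q * u k)) (+-comm c (q * v k)) ⟩
    ∣ q * u k + c - q * v k + c ∣          ≡⟨ cong₂ ∣_-_∣ (u-step k) (v-step k) ⟩
    ∣ 2 ^ b k * u (suc k) - 2 ^ b k * v (suc k) ∣ ≡⟨ *-distribˡ-∣-∣ (2 ^ b k) (u (suc k)) (v (suc k)) ⟨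
    2 ^ b k * gap (suc k)                  ∎
    where open ≡-Reasoning

  2^[1+m]∣2^e*y : ∀ {m y} e → 1 ≤ e → 2 ^ m ∣ y → 2 ^ suc m ∣ 2 ^ e * y
  2^[1+m]∣2^e*y {m} {y} (suc e) _ 2^m∣y =
    subst (2 ^ suc m ∣_) (sym (*-assoc 2 (2 ^ e) y))
          (*-pres-∣ (∣-refl {2}) (∣-trans 2^m∣y (n∣m*n (2 ^ e))))

  -- Every gap is divisible by every power of 2, by induction on the power:
  -- 2^(m+1) divides both q g_k = g_k + 2d g_k and 2d g_k, hence g_k.
  2^m∣gap : ∀ m k → 2 ^ m ∣ gap k
  2^m∣gap zero    k = divides (gap k) (sym (*-identityʳ (gap k)))
  2^m∣gap (suc m) k = ∣m+n∣m⇒∣n 2^[1+m]∣2dg+g 2^[1+m]∣2dg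
    where
    2^[1+m]∣2dg : 2 ^ suc m ∣ 2 * d * gap k
    2^[1+m]∣2dg = subst (2 ^ suc m ∣_) (sym (*-assoc 2 d (gap k)))
                        (*-pres-∣ (∣-refl {2}) (∣-trans (2^m∣gap m k) (n∣m*n d)))
    2^[1+m]∣2dg+g : 2 ^ suc m ∣ 2 * d * gap k + gap k
    2^[1+m]∣2dg+g = subst (2 ^ suc m ∣_) (trans (sym (gap-step k)) (+-comm (gap k) (2 * d * gap k)))
                          (2^[1+m]∣2^e*y {m} (b k) (b-positive k) (2^m∣gap m (suc k)))

  sequences-agree : ∀ k → u k ≡ v k
  sequences-agree k = ∣m-n∣≡0⇒m≡n (divisible-by-all-powers-of-2⇒0 (gap k) (λ m → 2^m∣gap m k))

trajectory-tails-agree : ∀ x y i j →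
  (∀ k → eseq x (suc (k + i)) ≡ eseq y (suc (k + j))) →
  (∀ k → 1 ≤ eseq x (suc (k + i))) →
  ∀ k → traj x (k + i) ≡ traj y (k + j)
trajectory-tails-agree x y i j same-exponents positive =
  TwoAdicRigidity.sequences-agree 1 1 (λ k → traj x (k + i)) (λ k → traj y (k + j))
    (λ k → eseq x (suc (k + i))) (λ k → trajectory-step x (k + i)) y-step positive
  where
  y-step : ∀ k → 3 * traj y (k + j) + 1 ≡ 2 ^ eseq x (suc (k + i)) * traj y (suc (k + j))
  y-step k = trans (trajectory-step y (k + j))
                   (cong (λ e → 2 ^ e * traj y (suc (k + j))) (sym (same-exponents k)))

eseq-positive : ∀ a x → IsESequence a → ΩConvergent a x → ∀ n → 1 ≤ n → 1 ≤ eseq x n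
eseq-positive a x positive conv n 1≤n = subst (1 ≤_) (conv n 1≤n) (positive n 1≤n)

eseq-periodic : ∀ a x l r → ΩConvergent a x → (∀ n → l < n → a n ≡ a (n + r)) →
  ∀ n → l < n → eseq x n ≡ eseq x (n + r)
eseq-periodic a x l r conv periodic n@(suc _) l<n =
  trans (sym (conv n (s≤s z≤n))) (trans (periodic n l<n) (conv (n + r) (s≤s z≤n)))

theorem3p5 : (a : ℕ → ℕ) → (x : ℕ) → IsESequence a → Periodic a → Odd x → 1 ≤ x → ΩConvergent a x → Periodic (traj x)
theorem3p5 a x isE (l , r , 1≤r , a-periodic) _ _ conv = l , r , 1≤r , traj-periodic
  where
  shifted-exponents : ∀ k → eseq x (suc (k + l)) ≡ eseq x (suc (k + (l + r)))
  shifted-exponents k = trans (eseq-periodic a x l r conv a-periodic (suc (k + l)) (s≤s (m≤n+m l k)))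
                              (cong (λ n → eseq x (suc n)) (+-assoc k l r))

  tails-agree : ∀ k → traj x (k + l) ≡ traj x (k + (l + r))
  tails-agree = trajectory-tails-agree x x l (l + r) shifted-exponents
                  (λ k → eseq-positive a x isE conv (suc (k + l)) (s≤s z≤n))

  traj-periodic : ∀ n → l < n → traj x n ≡ traj x (n + r)
  traj-periodic n l<n = subst (λ m → traj x m ≡ traj x (m + r)) (m∸n+n≡m (<⇒≤ l<n))
    (trans (tails-agree (n ∸ l)) (cong (traj x) (sym (+-assoc (n ∸ l) l r))))
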